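{- For any positive integers $k$ and $m$, if $n$ is sufficiently large, then every proper edge-coloring of $C_{2k+1}\langle n\rangle$ contains a rainbow copy of $C_{2k+1}\langle m\rangle$.
   Context: A blowup of a graph $B$ is obtained by replacing each vertex $v$ by a set $S(v)$ and each edge $uv$ by the complete bipartite graph between $S(u)$ and $S(v)$; it is balanced if every $|S(v)|$ equals $t$ or $t+1$ for some $t$. $C_{2k+1}\langle n\rangle$ denotes an (arbitrarily chosen) $n$-vertex balanced blowup of the cycle $C_{2k+1}$. A copy of a graph in an edge-colored graph is rainbow if all its edges receive distinct colors. -}

module Defs where

open import Data.Nat using (ℕ; zero; suc; _+_; _*_; _≥_; _%_)
open import Data.Fin using (Fin; toℕ; _≟_)
open import Data.List using (length; filter; allFin)
open import Data.Product using (Σ; ∃; _×_)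
open import Data.Sum using (_⊎_)
open import Relation.Binary.PropositionalEquality using (_≡_; _≢_)

cycLen : ℕ → ℕ
cycLen k = suc (2 * k)

CycAdj : (k : ℕ) → Fin (cycLen k) → Fin (cycLen k) → Set
CycAdj k i j = (toℕ j ≡ (toℕ i + 1) % cycLen k) ⊎ (toℕ i ≡ (toℕ j + 1) % cycLen k)

partSize : ∀ {n L} → (Fin n → Fin L) → Fin L → ℕ
partSize {n} f i = length (filter (λ v → f v ≟ i) (allFin n))

-- f : Fin n → Fin (2k+1) describes a blowup of C_{2k+1} on vertex set Fin n
-- (vertex v lies in S(f v)); it is balanced if all parts have size t or t+1.
Balanced : ∀ {n L} → (Fin n → Fin L) → Set
Balanced {L = L} f = ∃ λ t → ∀ i → (partSize f i ≡ t) ⊎ (partSize f i ≡ suc t)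

-- Adjacency in the blowup given by f: complete bipartite between S(i), S(j) for cycle edges ij.
BlowAdj : ∀ k {n} → (Fin n → Fin (cycLen k)) → Fin n → Fin n → Set
BlowAdj k f u v = CycAdj k (f u) (f v)

Symmetric : ∀ {n} → (Fin n → Fin n → ℕ) → Set
Symmetric {n} c = ∀ (u v : Fin n) → c u v ≡ c v u

Proper : ∀ {n} → (Fin n → Fin n → Set) → (Fin n → Fin n → ℕ) → Set
Proper {n} adj c = ∀ (u v w : Fin n) → adj u v → adj u w → c u v ≡ c u w → v ≡ w

RainbowCopy : ∀ {m n} → (Fin m → Fin m → Set) → (Fin n → Fin n → Set) → (Fin n → Fin n → ℕ) → Set
RainbowCopy {m} {n} adjH adjG c =
  Σ (Fin m → Fin n) λ φ →
    (∀ a b → φ a ≡ φ b → a ≡ b) ×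
    (∀ a b → adjH a b → adjG (φ a) (φ b)) ×
    (∀ a b a' b' → adjH a b → adjH a' b' → c (φ a) (φ b) ≡ c (φ a') (φ b') →
       (a ≡ a' × b ≡ b') ⊎ (a ≡ b' × b ≡ a'))

-- Embed the vertices of the small blowup greedily, each into its prescribed part. A new vertex
-- only has to avoid the vertices already used and, for each used vertex p and each colour c
-- already used, the neighbour of p of colour c, which is unique by properness. These are at
-- most m + m³ vertices, and balancedness makes every part of a large blowup bigger than that.
module Submission where

open import Defs
open import Data.Bool using (true; false; if_then_else_)
open import Data.Empty using (⊥-elim)
open import Data.Fin using (Fin; zero; suc; toℕ; _≟_)
open import Data.Fin.Properties using (pigeonhole; <⇒≢; toℕ<n)
open import Data.List using (List; []; _∷_; _++_; length; lookup; filter; take; concat; tabulate; allFin)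
open import Data.List.Properties using (length-++; length-tabulate; length-take)
open import Data.List.Membership.Propositional using (_∈_; _∉_; find; lose)
open import Data.List.Membership.Propositional.Properties
  using (∈-lookup; ∈-tabulate⁺; ∈-allFin; ∈-concat⁺′; ∈-++⁺ˡ; ∈-++⁺ʳ; ∈-filter⁺; ∈-filter⁻)
import Data.List.Membership.Setoid.Properties as SetoidMembership
open import Data.List.Relation.Unary.All as All using (All)
open import Data.List.Relation.Unary.Any as Any using (Any; here; any?; index)
import Data.List.Relation.Unary.AllPairs as AllPairs
open import Data.List.Relation.Unary.Unique.Propositional using (Unique)
open import Data.List.Relation.Unary.Unique.Propositional.Properties using (filter⁺; allFin⁺)
open import Data.Nat using (ℕ; zero; suc; _+_; _*_; _%_; _≤_; _<_; _≥_; z≤n; s≤s⁻¹)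
  renaming (_≟_ to _≟ℕ_)
open import Data.Nat.DivMod using (m<n⇒m%n≡m; n%n≡0)
open import Data.Nat.Properties
  using (+-0-commutativeMonoid; +-comm; *-identityʳ; +-mono-≤; *-mono-≤; ≤-refl; ≤-trans; ≤-reflexive;
         ≤-<-trans; <-≤-trans; module ≤-Reasoning; n≤1+n; <⇒≤; m≤n⇒m<n∨m≡n; 1+n≢n; m⊓n≤m; *-cancelˡ-<)
open import Data.Product using (Σ; ∃; _×_; _,_; proj₂)
open import Data.Sum using (_⊎_; inj₁; inj₂; swap; reduce)
import Data.Vec.Functional as Vector
open import Function using (_∘_)
open import Relation.Binary.Definitions using (DecidableEquality)
open import Relation.Binary.PropositionalEquality
  using (_≡_; _≢_; refl; sym; trans; cong; cong₂; subst₂; setoid; module ≡-Reasoning)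
open import Relation.Nullary using (¬_; Dec; yes; no; does; contradiction)
open import Relation.Nullary.Decidable using (decidable-stable; _×-dec_; _⊎-dec_)
open import Algebra.Properties.CommutativeMonoid.Sum +-0-commutativeMonoid
  using (sum-syntax; ∑-distrib-+; sum-replicate-zero; sum-cong-≗)

indicator : ∀ {L} → Fin L → Fin L → ℕ
indicator i j = if does (i ≟ j) then 1 else 0

∑-indicator : ∀ {L} (i : Fin L) → ∑[ j < L ] indicator i j ≡ 1
∑-indicator {suc L} zero    = cong suc (sum-replicate-zero L)
∑-indicator {suc L} (suc i) = ∑-indicator i

∑-≤ : ∀ {L} (h : Fin L → ℕ) {b} → (∀ j → h j ≤ b) → ∑[ j < L ] h j ≤ L * b
∑-≤ {zero}  h h≤b = z≤n
∑-≤ {suc L} h h≤b = +-mono-≤ (h≤b zero) (∑-≤ (h ∘ suc) (h≤b ∘ suc))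

module _ {A : Set} {L : ℕ} (f : A → Fin L) where

  classSize : List A → Fin L → ℕ
  classSize xs j = length (filter (λ x → f x ≟ j) xs)

  classSize-∷ : ∀ x xs j → classSize (x ∷ xs) j ≡ indicator (f x) j + classSize xs j
  classSize-∷ x xs j with does (f x ≟ j)
  ... | true  = refl
  ... | false = refl

  length≡∑classSize : ∀ xs → length xs ≡ ∑[ j < L ] classSize xs j
  length≡∑classSize []       = sym (sum-replicate-zero L)
  length≡∑classSize (x ∷ xs) = begin
    suc (length xs)                                          ≡⟨ cong₂ _+_ (sym (∑-indicator (f x))) (length≡∑classSize xs) ⟩
    ∑[ j < L ] indicator (f x) j + ∑[ j < L ] classSize xs j  ≡⟨ sym (∑-distrib-+ (indicator (f x)) (classSize xs)) ⟩
    ∑[ j < L ] (indicator (f x) j + classSize xs j)          ≡⟨ sym (sum-cong-≗ (classSize-∷ x xs)) ⟩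
    ∑[ j < L ] classSize (x ∷ xs) j                          ∎
    where open ≡-Reasoning

∑partSize : ∀ {n L} (f : Fin n → Fin L) → ∑[ j < L ] partSize f j ≡ n
∑partSize {n} f = trans (sym (length≡∑classSize f (allFin n))) (length-tabulate (λ v → v))

balanced⇒partSize> : ∀ {n L} (f : Fin n → Fin L) → Balanced f → ∀ Q → L * suc Q < n → ∀ j → Q < partSize f j
balanced⇒partSize> {L = L} f (t , balanced) Q n-large j = <-≤-trans Q<t (t≤part j)
  where
  t≤part : ∀ j → t ≤ partSize f j
  t≤part j with balanced j
  ... | inj₁ part≡t  = ≤-reflexive (sym part≡t)
  ... | inj₂ part≡1+t = ≤-trans (n≤1+n t) (≤-reflexive (sym part≡1+t))

  part≤1+t : ∀ j → partSize f j ≤ suc t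
  part≤1+t j with balanced j
  ... | inj₁ part≡t  = ≤-trans (≤-reflexive part≡t) (n≤1+n t)
  ... | inj₂ part≡1+t = ≤-reflexive part≡1+t

  Q<t : Q < t
  Q<t = s≤s⁻¹ (*-cancelˡ-< L (suc Q) (suc t)
          (<-≤-trans n-large (≤-trans (≤-reflexive (sym (∑partSize f))) (∑-≤ (partSize f) part≤1+t))))

lookup-injective : ∀ {A : Set} {xs : List A} → Unique xs → ∀ i j → lookup xs i ≡ lookup xs j → i ≡ j
lookup-injective (_    AllPairs.∷ _) zero    zero    _  = refl
lookup-injective (x∉xs AllPairs.∷ _) zero    (suc j) eq = contradiction eq (All.lookup x∉xs (∈-lookup j))
lookup-injective (x∉xs AllPairs.∷ _) (suc i) zero    eq = contradiction (sym eq) (All.lookup x∉xs (∈-lookup i))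
lookup-injective (_    AllPairs.∷ u) (suc i) (suc j) eq = cong suc (lookup-injective u i j eq)

module _ {A : Set} (_≟A_ : DecidableEquality A) where
  open import Data.List.Membership.DecPropositional _≟A_ using (_∈?_; _∉?_)

  lookup∈-of-¬∃∉ : ∀ {xs ys : List A} → ¬ Any (_∉ ys) xs → ∀ i → lookup xs i ∈ ys
  lookup∈-of-¬∃∉ {xs} {ys} none∉ i = decidable-stable (lookup xs i ∈? ys) (none∉ ∘ lose (∈-lookup i))

  ∃-∉-shorter : ∀ {xs ys : List A} → Unique xs → length ys < length xs → ∃ λ x → x ∈ xs × x ∉ ys
  ∃-∉-shorter {xs} {ys} xs-unique ys<xs with any? (_∉? ys) xs
  ... | yes some∉ = find some∉
  ... | no none∉
    with i , j , i<j , same-index ← pigeonhole ys<xs (index ∘ lookup∈-of-¬∃∉ none∉)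
    = contradiction (lookup-injective xs-unique i j same-entry) (<⇒≢ i<j)
    where
    same-entry : lookup xs i ≡ lookup xs j
    same-entry = SetoidMembership.index-injective (setoid A)
                   (lookup∈-of-¬∃∉ none∉ i) (lookup∈-of-¬∃∉ none∉ j) same-index

length-concat-tabulate : ∀ {A : Set} {i b} (g : Fin i → List A) → (∀ p → length (g p) ≤ b) →
                         length (concat (tabulate g)) ≤ i * b
length-concat-tabulate {i = zero}  g g≤b = z≤n
length-concat-tabulate {i = suc i} g g≤b = begin
  length (g zero ++ concat (tabulate (g ∘ suc)))         ≡⟨ length-++ (g zero) ⟩
  length (g zero) + length (concat (tabulate (g ∘ suc))) ≤⟨ +-mono-≤ (g≤b zero) (length-concat-tabulate (g ∘ suc) (g≤b ∘ suc)) ⟩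
  _ + i * _                                              ∎
  where open ≤-Reasoning

∈-concat-tabulate : ∀ {A : Set} {i} {y : A} (g : Fin i → List A) p → y ∈ g p → y ∈ concat (tabulate g)
∈-concat-tabulate g p y∈gp = ∈-concat⁺′ y∈gp (∈-tabulate⁺ p)

∈-take-1 : ∀ {A : Set} {y : A} {xs} → y ∈ xs → (∀ {z} → z ∈ xs → z ≡ y) → y ∈ take 1 xs
∈-take-1 (here refl)   _      = here refl
∈-take-1 (Any.there _) unique = here (sym (unique (here refl)))

length-take-1 : ∀ {A : Set} (xs : List A) → length (take 1 xs) ≤ 1
length-take-1 xs = ≤-trans (≤-reflexive (length-take 1 xs)) (m⊓n≤m 1 (length xs))

Blowup : ∀ {L n} → (Fin L → Fin L → Set) → (Fin n → Fin L) → Fin n → Fin n → Set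
Blowup R f u v = R (f u) (f v)

SameEdge : ∀ {m} → Fin m → Fin m → Fin m → Fin m → Set
SameEdge a b a′ b′ = (a ≡ a′ × b ≡ b′) ⊎ (a ≡ b′ × b ≡ a′)

forbiddenBound : ℕ → ℕ
forbiddenBound i = i + i * (i * i)

forbiddenBound-mono : ∀ {i m} → i ≤ m → forbiddenBound i ≤ forbiddenBound m
forbiddenBound-mono i≤m = +-mono-≤ i≤m (*-mono-≤ i≤m (*-mono-≤ i≤m i≤m))

module GreedyEmbedding {L : ℕ} (R : Fin L → Fin L → Set) (R? : ∀ i j → Dec (R i j))
    (R-sym : ∀ {i j} → R i j → R j i) (R-irrefl : ∀ {i} → ¬ R i i)
    {n : ℕ} (f : Fin n → Fin L) (c : Fin n → Fin n → ℕ)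
    (c-sym : Symmetric c) (c-proper : Proper (Blowup R f) c) where

  IsColourNeighbour : Fin n → ℕ → Fin n → Set
  IsColourNeighbour u col y = Blowup R f u y × c u y ≡ col

  isColourNeighbour? : ∀ u col y → Dec (IsColourNeighbour u col y)
  isColourNeighbour? u col y = R? (f u) (f y) ×-dec (c u y ≟ℕ col)

  -- By properness the filtered list has at most one element, so `take 1` loses nothing.
  colourNeighbour : Fin n → ℕ → List (Fin n)
  colourNeighbour u col = take 1 (filter (isColourNeighbour? u col) (allFin n))

  ∈-colourNeighbour : ∀ {u col y} → IsColourNeighbour u col y → y ∈ colourNeighbour u col
  ∈-colourNeighbour {u} {col} {y} (u~y , uy≡col) =
    ∈-take-1 (∈-filter⁺ (isColourNeighbour? u col) (∈-allFin y) (u~y , uy≡col)) z≡y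
    where
    z≡y : ∀ {z} → z ∈ filter (isColourNeighbour? u col) (allFin n) → z ≡ y
    z≡y z∈ with u~z , uz≡col ← proj₂ (∈-filter⁻ (isColourNeighbour? u col) {xs = allFin n} z∈) =
      c-proper u _ y u~z u~y (trans uz≡col (sym uy≡col))

  usedColourNeighbours : ∀ {i} → (Fin i → Fin n) → Fin i → List (Fin n)
  usedColourNeighbours ψ p =
    concat (tabulate λ r → concat (tabulate λ s → colourNeighbour (ψ p) (c (ψ r) (ψ s))))

  forbidden : ∀ {i} → (Fin i → Fin n) → List (Fin n)
  forbidden ψ = tabulate ψ ++ concat (tabulate (usedColourNeighbours ψ))

  length-forbidden : ∀ {i} (ψ : Fin i → Fin n) → length (forbidden ψ) ≤ forbiddenBound i
  length-forbidden {i} ψ = begin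
    length (forbidden ψ)                                                       ≡⟨ length-++ (tabulate ψ) ⟩
    length (tabulate ψ) + length (concat (tabulate (usedColourNeighbours ψ))) ≤⟨ +-mono-≤ (≤-reflexive (length-tabulate ψ)) bound ⟩
    i + i * (i * (i * 1))                                                      ≡⟨ cong (λ x → i + i * (i * x)) (*-identityʳ i) ⟩
    forbiddenBound i                                                           ∎
    where
    open ≤-Reasoning
    bound : length (concat (tabulate (usedColourNeighbours ψ))) ≤ i * (i * (i * 1))
    bound = length-concat-tabulate (usedColourNeighbours ψ) λ p →
            length-concat-tabulate _ λ r → length-concat-tabulate _ λ s →
            length-take-1 (filter (isColourNeighbour? (ψ p) (c (ψ r) (ψ s))) (allFin n))

  record RainbowEmbedding {i} (g : Fin i → Fin L) (ψ : Fin i → Fin n) : Set where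
    field
      injective      : ∀ a b → ψ a ≡ ψ b → a ≡ b
      respects-parts : ∀ a → f (ψ a) ≡ g a
      rainbow        : ∀ a b a′ b′ → Blowup R f (ψ a) (ψ b) → Blowup R f (ψ a′) (ψ b′) →
                       c (ψ a) (ψ b) ≡ c (ψ a′) (ψ b′) → SameEdge a b a′ b′

  extend : ∀ {i} {g : Fin (suc i) → Fin L} {ψ : Fin i → Fin n} → RainbowEmbedding (g ∘ suc) ψ →
           ∀ x → f x ≡ g zero → x ∉ forbidden ψ → RainbowEmbedding g (x Vector.∷ ψ)
  extend {i} {g} {ψ} E x fx≡g0 x∉forbidden = record
    { injective = injective′ ; respects-parts = respects-parts′ ; rainbow = rainbow′ }
    where
    open RainbowEmbedding E

    x≢ψ : ∀ a → x ≢ ψ a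
    x≢ψ a x≡ψa = x∉forbidden (∈-++⁺ˡ (subst₂ _∈_ (sym x≡ψa) refl (∈-tabulate⁺ a)))

    new-colour-unused : ∀ b r s → Blowup R f x (ψ b) → c x (ψ b) ≢ c (ψ r) (ψ s)
    new-colour-unused b r s x~ψb same = x∉forbidden (∈-++⁺ʳ (tabulate ψ)
      (∈-concat-tabulate _ b (∈-concat-tabulate _ r (∈-concat-tabulate _ s
        (∈-colourNeighbour (R-sym x~ψb , trans (c-sym (ψ b) x) same))))))

    new-colour-unusedʳ : ∀ b r s → Blowup R f (ψ b) x → c (ψ b) x ≢ c (ψ r) (ψ s)
    new-colour-unusedʳ b r s ψb~x same = new-colour-unused b r s (R-sym ψb~x) (trans (c-sym x (ψ b)) same)

    new-colours-distinct : ∀ b b′ → Blowup R f x (ψ b) → Blowup R f x (ψ b′) → c x (ψ b) ≡ c x (ψ b′) → b ≡ b′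
    new-colours-distinct b b′ x~ψb x~ψb′ same = injective b b′ (c-proper x (ψ b) (ψ b′) x~ψb x~ψb′ same)

    ψ′ : Fin (suc i) → Fin n
    ψ′ = x Vector.∷ ψ

    injective′ : ∀ a b → ψ′ a ≡ ψ′ b → a ≡ b
    injective′ zero    zero    _  = refl
    injective′ zero    (suc b) eq = ⊥-elim (x≢ψ b eq)
    injective′ (suc a) zero    eq = ⊥-elim (x≢ψ a (sym eq))
    injective′ (suc a) (suc b) eq = cong suc (injective a b eq)

    respects-parts′ : ∀ a → f (ψ′ a) ≡ g a
    respects-parts′ zero    = fx≡g0
    respects-parts′ (suc a) = respects-parts a

    rainbow′ : ∀ a b a′ b′ → Blowup R f (ψ′ a) (ψ′ b) → Blowup R f (ψ′ a′) (ψ′ b′) →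
               c (ψ′ a) (ψ′ b) ≡ c (ψ′ a′) (ψ′ b′) → SameEdge a b a′ b′
    rainbow′ zero zero _ _ x~x _ _ = ⊥-elim (R-irrefl x~x)
    rainbow′ _ _ zero zero _ x~x _ = ⊥-elim (R-irrefl x~x)
    rainbow′ (suc a) (suc b) (suc a′) (suc b′) e e′ same with rainbow a b a′ b′ e e′ same
    ... | inj₁ (refl , refl) = inj₁ (refl , refl)
    ... | inj₂ (refl , refl) = inj₂ (refl , refl)
    rainbow′ zero    (suc b) (suc a′) (suc b′) e _ same = ⊥-elim (new-colour-unused b a′ b′ e same)
    rainbow′ (suc b) zero    (suc a′) (suc b′) e _ same = ⊥-elim (new-colour-unusedʳ b a′ b′ e same)
    rainbow′ (suc a) (suc b) zero     (suc b′) _ e same = ⊥-elim (new-colour-unused b′ a b e (sym same))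
    rainbow′ (suc a) (suc b) (suc b′) zero     _ e same = ⊥-elim (new-colour-unusedʳ b′ a b e (sym same))
    rainbow′ zero (suc b) zero (suc b′) e e′ same =
      inj₁ (refl , cong suc (new-colours-distinct b b′ e e′ same))
    rainbow′ zero (suc b) (suc a′) zero e e′ same =
      inj₂ (refl , cong suc (new-colours-distinct b a′ e (R-sym e′) (trans same (c-sym (ψ a′) x))))
    rainbow′ (suc a) zero zero (suc b′) e e′ same =
      inj₂ (cong suc (new-colours-distinct a b′ (R-sym e) e′ (trans (c-sym x (ψ a)) same)) , refl)
    rainbow′ (suc a) zero (suc a′) zero e e′ same =
      inj₁ (cong suc (new-colours-distinct a a′ (R-sym e) (R-sym e′)
                       (trans (c-sym x (ψ a)) (trans same (c-sym (ψ a′) x)))) , refl)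

  embed : ∀ {m} → (∀ j → forbiddenBound m < partSize f j) →
          ∀ {i} → i ≤ m → (g : Fin i → Fin L) → Σ (Fin i → Fin n) (RainbowEmbedding g)
  embed parts-large {zero} _ g =
    (λ ()) , record { injective = λ () ; respects-parts = λ () ; rainbow = λ () }
  embed parts-large {suc i} i<m g
    with ψ , E ← embed parts-large (<⇒≤ i<m) (g ∘ suc)
    with x , x∈part , x∉forbidden ← ∃-∉-shorter _≟_ (filter⁺ (λ v → f v ≟ g zero) (allFin⁺ n))
           (≤-<-trans (length-forbidden ψ) (≤-<-trans (forbiddenBound-mono (<⇒≤ i<m)) (parts-large (g zero))))
    = x Vector.∷ ψ , extend E x (proj₂ (∈-filter⁻ (λ v → f v ≟ g zero) {xs = allFin n} x∈part)) x∉forbidden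

  rainbowCopy-of-embedding : ∀ {m} {g : Fin m → Fin L} {ψ} → RainbowEmbedding g ψ →
                             RainbowCopy (Blowup R g) (Blowup R f) c
  rainbowCopy-of-embedding {g = g} {ψ} E =
    ψ , injective , preserves , λ a b a′ b′ e e′ → rainbow a b a′ b′ (preserves a b e) (preserves a′ b′ e′)
    where
    open RainbowEmbedding E
    preserves : ∀ a b → Blowup R g a b → Blowup R f (ψ a) (ψ b)
    preserves a b = subst₂ R (sym (respects-parts a)) (sym (respects-parts b))

  rainbowCopy : ∀ {m} (g : Fin m → Fin L) → (∀ j → forbiddenBound m < partSize f j) →
                RainbowCopy (Blowup R g) (Blowup R f) c
  rainbowCopy g parts-large = rainbowCopy-of-embedding (proj₂ (embed parts-large ≤-refl g))

a≢[a+1]% : ∀ {a L} → a < suc (suc L) → a ≢ (a + 1) % suc (suc L)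
a≢[a+1]% {a} {L} a<L a≡[a+1]% with m≤n⇒m<n∨m≡n (subst₂ _≤_ (+-comm 1 a) refl a<L)
... | inj₁ a+1<L = 1+n≢n (sym (trans a≡[a+1]% (trans (m<n⇒m%n≡m a+1<L) (+-comm a 1))))
... | inj₂ a+1≡L
  with refl ← trans a≡[a+1]% (trans (cong (_% suc (suc L)) a+1≡L) (n%n≡0 (suc (suc L))))
  with () ← a+1≡L

CycAdj? : ∀ k i j → Dec (CycAdj k i j)
CycAdj? k i j = (toℕ j ≟ℕ (toℕ i + 1) % cycLen k) ⊎-dec (toℕ i ≟ℕ (toℕ j + 1) % cycLen k)

CycAdj-irrefl : ∀ {k} → k ≥ 1 → ∀ {i} → ¬ CycAdj k i i
CycAdj-irrefl {suc k} _ {i} i~i = a≢[a+1]% (toℕ<n i) (reduce i~i)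

proposition6 : ∀ (k m : ℕ) → k ≥ 1 → m ≥ 1 →
    ∃ λ N → ∀ (n : ℕ) → n ≥ N →
      ∀ (f : Fin n → Fin (cycLen k)) → Balanced f →
      ∀ (g : Fin m → Fin (cycLen k)) → Balanced g →
      ∀ (c : Fin n → Fin n → ℕ) → Symmetric c → Proper (BlowAdj k f) c →
      RainbowCopy (BlowAdj k g) (BlowAdj k f) c
proposition6 k m k≥1 _ = suc (cycLen k * suc (forbiddenBound m)) , λ n n-large f f-balanced g _ c c-sym c-proper →
  GreedyEmbedding.rainbowCopy (CycAdj k) (CycAdj? k) swap (CycAdj-irrefl k≥1) f c c-sym c-proper g
    (balanced⇒partSize> f f-balanced (forbiddenBound m) n-large)
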